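{- Let $(B,\cdot,\circ)$ be a skew left brace whose associated solution $(B,\lambda,\rho)$ is $2$-reductive. Then the group $(B,\cdot)$ is nilpotent of class at most $2$.
   Context: A skew left brace is $(B,\cdot,\circ)$ with $(B,\cdot)$ and $(B,\circ)$ groups such that $a\circ(b\cdot c)=(a\circ b)\cdot a^{ -1}\cdot(a\circ c)$ for all $a,b,c$; $a^{ -1}$ is the inverse in $(B,\cdot)$ and $\bar a$ the inverse in $(B,\circ)$. The associated solution is $r(a,b)=(\lambda_a(b),\rho_b(a))$ with $\lambda_a(b)=a^{ -1}\cdot(a\circ b)$ and $\rho_b(a)=\overline{\lambda_a(b)}\circ a\circ b$. It is $2$-reductive if for all $x,y\in B$: $\lambda_{\lambda_x(y)}=\lambda_y$, $\rho_{\rho_x(y)}=\rho_y$, $\lambda_{\rho_x(y)}=\lambda_y$, $\rho_{\lambda_x(y)}=\rho_y$. -}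

module Defs where

open import Level using (Level; suc)
open import Relation.Binary.PropositionalEquality using (_≡_)
open import Algebra.Structures using (IsGroup)
open import Data.Product using (_×_)

record SkewBrace (ℓ : Level) : Set (suc ℓ) where
  infixl 7 _·_ _∘_
  field
    B       : Set ℓ
    _·_     : B → B → B
    one     : B
    _⁻¹     : B → B
    _∘_     : B → B → B
    oneᵒ    : B
    inv∘    : B → B
    ·-isGroup : IsGroup _≡_ _·_ one _⁻¹
    ∘-isGroup : IsGroup _≡_ _∘_ oneᵒ inv∘
    brace   : ∀ a b c → a ∘ (b · c) ≡ ((a ∘ b) · (a ⁻¹)) · (a ∘ c)

  lam : B → B → B
  lam a b = (a ⁻¹) · (a ∘ b)

  rho : B → B → B
  rho b a = (inv∘ (lam a b) ∘ a) ∘ b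

  -- The associated solution r(a,b) = (λ_a(b), ρ_b(a)) is 2-reductive.
  -- Equalities of maps λ_u = λ_v are stated pointwise.
  Is2Reductive : Set ℓ
  Is2Reductive =
    (∀ x y z → lam (lam x y) z ≡ lam y z) ×
    ((∀ x y z → rho (rho x y) z ≡ rho y z) ×
    ((∀ x y z → lam (rho x y) z ≡ lam y z) ×
     (∀ x y z → rho (lam x y) z ≡ rho y z)))

  comm : B → B → B
  comm x y = (((x ⁻¹) · (y ⁻¹)) · x) · y

  -- (B,·) is nilpotent of class at most 2: [B,B] ⊆ Z(B), i.e. every
  -- commutator is central (equivalently [[x,y],z] = 1 for all x,y,z).
  NilpotentClass≤2 : Set ℓ
  NilpotentClass≤2 = ∀ x y z → comm x y · z ≡ z · comm x y

module Submission where

-- Write x ∼ y when x y⁻¹ is central (congruence modulo the centre) and a ^ w = w⁻¹ a w.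
-- Since λ is a homomorphism from (B,∘) to Aut(B,·), one computes ρ_b(a) = λ_ū(a ^ u) with
-- u = λ_a(b). The axioms λ_{λ_x(y)} = λ_y and ρ_{λ_x(y)} = ρ_y then force
-- a ^ λ_a(λ_x(y)) = a ^ λ_a(y) for every a, whence λ_x(y) ∼ y, and so ρ_x(y) = λ_x̄(y ^ x) ∼ y ^ x.
-- The other two axioms give ρ_x(y) ∼ y in the same way, hence y ^ x ∼ y for all x, y, which
-- says that every commutator is central.

open import Level using (Level; _⊔_)
open import Algebra.Bundles using (Group)
import Algebra.Properties.Group as GroupProperties
open import Data.Product using (_,_)
open import Defs

module Centre {g₁ g₂} (G : Group g₁ g₂) where
  open Group G
  open GroupProperties G
  open import Relation.Binary.Reasoning.Setoid setoid

  infixl 8 _^_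
  infix 4 _∼_

  Commute : Carrier → Carrier → Set g₂
  Commute x y = x ∙ y ≈ y ∙ x

  Central : Carrier → Set (g₁ ⊔ g₂)
  Central c = ∀ x → Commute c x

  _^_ : Carrier → Carrier → Carrier
  a ^ w = w ⁻¹ ∙ a ∙ w

  [_,_] : Carrier → Carrier → Carrier
  [ x , y ] = x ⁻¹ ∙ y ⁻¹ ∙ x ∙ y

  _∼_ : Carrier → Carrier → Set (g₁ ⊔ g₂)
  x ∼ y = Central (x // y)

  central-resp : ∀ {c d} → c ≈ d → Central c → Central d
  central-resp {c} {d} c≈d central-c x = begin
    d ∙ x ≈⟨ ∙-congʳ c≈d ⟨
    c ∙ x ≈⟨ central-c x ⟩
    x ∙ c ≈⟨ ∙-congˡ c≈d ⟩
    x ∙ d ∎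

  central-⁻¹ : ∀ {c} → Central c → Central (c ⁻¹)
  central-⁻¹ {c} central-c x = ∙-cancelˡ c _ _ (begin
    c ∙ (c ⁻¹ ∙ x)  ≈⟨ \\-leftDividesˡ c x ⟩
    x               ≈⟨ //-rightDividesʳ c x ⟨
    x ∙ c ∙ c ⁻¹    ≈⟨ ∙-congʳ (central-c x) ⟨
    c ∙ x ∙ c ⁻¹    ≈⟨ assoc c x (c ⁻¹) ⟩
    c ∙ (x ∙ c ⁻¹)  ∎)

  central-∙ : ∀ {c d} → Central c → Central d → Central (c ∙ d)
  central-∙ {c} {d} central-c central-d x = begin
    c ∙ d ∙ x    ≈⟨ assoc c d x ⟩
    c ∙ (d ∙ x)  ≈⟨ ∙-congˡ (central-d x) ⟩
    c ∙ (x ∙ d)  ≈⟨ assoc c x d ⟨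
    c ∙ x ∙ d    ≈⟨ ∙-congʳ (central-c x) ⟩
    x ∙ c ∙ d    ≈⟨ assoc x c d ⟩
    x ∙ (c ∙ d)  ∎

  ∼-sym : ∀ {x y} → x ∼ y → y ∼ x
  ∼-sym {x} {y} x∼y = central-resp (⁻¹-anti-homo-// x y) (central-⁻¹ x∼y)

  ∼-trans : ∀ {x y z} → x ∼ y → y ∼ z → x ∼ z
  ∼-trans {x} {y} {z} x∼y y∼z = central-resp x//y∙y//z≈x//z (central-∙ x∼y y∼z)
    where
    x//y∙y//z≈x//z : (x // y) ∙ (y // z) ≈ x // z
    x//y∙y//z≈x//z = begin
      x ∙ y ⁻¹ ∙ (y ∙ z ⁻¹)    ≈⟨ assoc x (y ⁻¹) (y ∙ z ⁻¹) ⟩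
      x ∙ (y ⁻¹ ∙ (y ∙ z ⁻¹))  ≈⟨ ∙-congˡ (\\-leftDividesʳ y (z ⁻¹)) ⟩
      x ∙ z ⁻¹                 ∎

  ∙-^ : ∀ w a → w ∙ a ^ w ≈ a ∙ w
  ∙-^ w a = begin
    w ∙ (w ⁻¹ ∙ a ∙ w)    ≈⟨ assoc w (w ⁻¹ ∙ a) w ⟨
    w ∙ (w ⁻¹ ∙ a) ∙ w    ≈⟨ ∙-congʳ (\\-leftDividesˡ w a) ⟩
    a ∙ w                 ∎

  ^-≈⇒commute : ∀ {a w y} → a ^ w ≈ a ^ y → Commute (w // y) a
  ^-≈⇒commute {a} {w} {y} a^w≈a^y = ∙-cancelʳ y _ _ (begin
    w ∙ y ⁻¹ ∙ a ∙ y        ≈⟨ assoc (w ∙ y ⁻¹) a y ⟩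
    w ∙ y ⁻¹ ∙ (a ∙ y)      ≈⟨ assoc w (y ⁻¹) (a ∙ y) ⟩
    w ∙ (y ⁻¹ ∙ (a ∙ y))    ≈⟨ ∙-congˡ (assoc (y ⁻¹) a y) ⟨
    w ∙ a ^ y               ≈⟨ ∙-congˡ a^w≈a^y ⟨
    w ∙ a ^ w               ≈⟨ ∙-^ w a ⟩
    a ∙ w                   ≈⟨ ∙-congˡ (//-rightDividesˡ y w) ⟨
    a ∙ (w ∙ y ⁻¹ ∙ y)      ≈⟨ assoc a (w ∙ y ⁻¹) y ⟨
    a ∙ (w ∙ y ⁻¹) ∙ y      ∎)

  ∼⇒^-≈ : ∀ {a w y} → w ∼ y → a ^ w ≈ a ^ y
  ∼⇒^-≈ {a} {w} {y} w∼y = ∙-cancelˡ w _ _ (begin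
    w ∙ a ^ w                ≈⟨ ∙-^ w a ⟩
    a ∙ w                    ≈⟨ ∙-congˡ (//-rightDividesˡ y w) ⟨
    a ∙ ((w // y) ∙ y)       ≈⟨ assoc a (w // y) y ⟨
    a ∙ (w // y) ∙ y         ≈⟨ ∙-congʳ (w∼y a) ⟨
    (w // y) ∙ a ∙ y         ≈⟨ assoc (w // y) a y ⟩
    (w // y) ∙ (a ∙ y)       ≈⟨ ∙-congˡ (∙-^ y a) ⟨
    (w // y) ∙ (y ∙ a ^ y)   ≈⟨ assoc (w // y) y (a ^ y) ⟨
    (w // y) ∙ y ∙ a ^ y     ≈⟨ ∙-congʳ (//-rightDividesˡ y w) ⟩
    w ∙ a ^ y                ∎)

  conjugates-∼⇒commutators-central : (∀ x y → y ^ x ∼ y) → ∀ x y → Central [ x , y ]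
  conjugates-∼⇒commutators-central conj∼ x y =
    central-resp (∙-congˡ (⁻¹-involutive y)) (conj∼ x (y ⁻¹))

module SkewBraceProperties {ℓ} (S : SkewBrace ℓ) where
  open SkewBrace S
  open import Relation.Binary.PropositionalEquality
  open ≡-Reasoning

  ·-group : Group ℓ ℓ
  ·-group = record { isGroup = ·-isGroup }

  ∘-group : Group ℓ ℓ
  ∘-group = record { isGroup = ∘-isGroup }

  open Group ·-group using (assoc; identityˡ; identityʳ; inverseʳ)
  open GroupProperties ·-group
    using (\\-leftDividesˡ; \\-leftDividesʳ; identityʳ-unique; inverseʳ-unique; ⁻¹-involutive)
  module ∘G = Group ∘-group
  module ∘P = GroupProperties ∘-group
  open Centre ·-group using (Commute; Central; _^_; _∼_; ∼-sym; ∼-trans; ^-≈⇒commute; ∼⇒^-≈)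

  ·-lam : ∀ a b → a · lam a b ≡ a ∘ b
  ·-lam a b = \\-leftDividesˡ a (a ∘ b)

  lam-· : ∀ a b c → lam a (b · c) ≡ lam a b · lam a c
  lam-· a b c = begin
    a ⁻¹ · (a ∘ (b · c))                  ≡⟨ cong (a ⁻¹ ·_) (brace a b c) ⟩
    a ⁻¹ · ((a ∘ b) · a ⁻¹ · (a ∘ c))     ≡⟨ assoc (a ⁻¹) ((a ∘ b) · a ⁻¹) (a ∘ c) ⟨
    a ⁻¹ · ((a ∘ b) · a ⁻¹) · (a ∘ c)     ≡⟨ cong (_· (a ∘ c)) (assoc (a ⁻¹) (a ∘ b) (a ⁻¹)) ⟨
    a ⁻¹ · (a ∘ b) · a ⁻¹ · (a ∘ c)       ≡⟨ assoc (a ⁻¹ · (a ∘ b)) (a ⁻¹) (a ∘ c) ⟩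
    a ⁻¹ · (a ∘ b) · (a ⁻¹ · (a ∘ c))     ∎

  lam-one : ∀ a → lam a one ≡ one
  lam-one a = identityʳ-unique (lam a one) (lam a one)
    (trans (sym (lam-· a one one)) (cong (lam a) (identityˡ one)))

  lam-⁻¹ : ∀ a b → lam a (b ⁻¹) ≡ lam a b ⁻¹
  lam-⁻¹ a b = inverseʳ-unique (lam a b) (lam a (b ⁻¹))
    (trans (sym (lam-· a b (b ⁻¹))) (trans (cong (lam a) (inverseʳ b)) (lam-one a)))

  lam-^ : ∀ a x w → lam a (x ^ w) ≡ lam a x ^ lam a w
  lam-^ a x w = begin
    lam a (w ⁻¹ · x · w)                  ≡⟨ lam-· a (w ⁻¹ · x) w ⟩
    lam a (w ⁻¹ · x) · lam a w            ≡⟨ cong (_· lam a w) (lam-· a (w ⁻¹) x) ⟩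
    lam a (w ⁻¹) · lam a x · lam a w      ≡⟨ cong (λ t → t · lam a x · lam a w) (lam-⁻¹ a w) ⟩
    lam a w ⁻¹ · lam a x · lam a w        ∎

  lam-commute : ∀ a {x y} → Commute x y → Commute (lam a x) (lam a y)
  lam-commute a {x} {y} xy≡yx = begin
    lam a x · lam a y  ≡⟨ lam-· a x y ⟨
    lam a (x · y)      ≡⟨ cong (lam a) xy≡yx ⟩
    lam a (y · x)      ≡⟨ lam-· a y x ⟩
    lam a y · lam a x  ∎

  oneᵒ≡one : oneᵒ ≡ one
  oneᵒ≡one = begin
    oneᵒ                     ≡⟨ identityʳ oneᵒ ⟨
    oneᵒ · one               ≡⟨ cong (oneᵒ ·_) (lam-one oneᵒ) ⟨
    oneᵒ · lam oneᵒ one      ≡⟨ ·-lam oneᵒ one ⟩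
    oneᵒ ∘ one               ≡⟨ ∘G.identityˡ one ⟩
    one                      ∎

  lam-oneᵒ : ∀ c → lam oneᵒ c ≡ c
  lam-oneᵒ c = begin
    oneᵒ ⁻¹ · (oneᵒ ∘ c)  ≡⟨ cong (oneᵒ ⁻¹ ·_) (∘G.identityˡ c) ⟩
    oneᵒ ⁻¹ · c           ≡⟨ cong (λ e → e ⁻¹ · c) oneᵒ≡one ⟩
    one ⁻¹ · c            ≡⟨ cong (one ⁻¹ ·_) (identityˡ c) ⟨
    one ⁻¹ · (one · c)    ≡⟨ \\-leftDividesʳ one c ⟩
    c                     ∎

  lam-∘ : ∀ a b c → lam (a ∘ b) c ≡ lam a (lam b c)
  lam-∘ a b c = begin
    (a ∘ b) ⁻¹ · (a ∘ b ∘ c)                             ≡⟨ cong ((a ∘ b) ⁻¹ ·_) a∘b∘c≡ ⟩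
    (a ∘ b) ⁻¹ · ((a ∘ b) · (a ⁻¹ · (a ∘ lam b c)))      ≡⟨ \\-leftDividesʳ (a ∘ b) _ ⟩
    a ⁻¹ · (a ∘ lam b c)                                 ∎
    where
    a∘b∘c≡ : a ∘ b ∘ c ≡ (a ∘ b) · (a ⁻¹ · (a ∘ lam b c))
    a∘b∘c≡ = begin
      a ∘ b ∘ c                            ≡⟨ ∘G.assoc a b c ⟩
      a ∘ (b ∘ c)                          ≡⟨ cong (a ∘_) (·-lam b c) ⟨
      a ∘ (b · lam b c)                    ≡⟨ brace a b (lam b c) ⟩
      (a ∘ b) · a ⁻¹ · (a ∘ lam b c)       ≡⟨ assoc (a ∘ b) (a ⁻¹) (a ∘ lam b c) ⟩
      (a ∘ b) · (a ⁻¹ · (a ∘ lam b c))     ∎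

  lam-inv∘ˡ : ∀ a c → lam (inv∘ a) (lam a c) ≡ c
  lam-inv∘ˡ a c = begin
    lam (inv∘ a) (lam a c)  ≡⟨ lam-∘ (inv∘ a) a c ⟨
    lam (inv∘ a ∘ a) c      ≡⟨ cong (λ t → lam t c) (∘G.inverseˡ a) ⟩
    lam oneᵒ c              ≡⟨ lam-oneᵒ c ⟩
    c                       ∎

  lam-inv∘ʳ : ∀ a c → lam a (lam (inv∘ a) c) ≡ c
  lam-inv∘ʳ a c = begin
    lam a (lam (inv∘ a) c)  ≡⟨ lam-∘ a (inv∘ a) c ⟨
    lam (a ∘ inv∘ a) c      ≡⟨ cong (λ t → lam t c) (∘G.inverseʳ a) ⟩
    lam oneᵒ c              ≡⟨ lam-oneᵒ c ⟩
    c                       ∎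

  lam-injective : ∀ a {x y} → lam a x ≡ lam a y → x ≡ y
  lam-injective a {x} {y} eq = begin
    x                       ≡⟨ lam-inv∘ˡ a x ⟨
    lam (inv∘ a) (lam a x)  ≡⟨ cong (lam (inv∘ a)) eq ⟩
    lam (inv∘ a) (lam a y)  ≡⟨ lam-inv∘ˡ a y ⟩
    y                       ∎

  lam-inv∘-cong : ∀ {u v} → (∀ z → lam u z ≡ lam v z) → ∀ z → lam (inv∘ u) z ≡ lam (inv∘ v) z
  lam-inv∘-cong {u} {v} lamu≗lamv z = begin
    lam (inv∘ u) z                           ≡⟨ cong (lam (inv∘ u)) (lam-inv∘ʳ v z) ⟨
    lam (inv∘ u) (lam v (lam (inv∘ v) z))    ≡⟨ cong (lam (inv∘ u)) (lamu≗lamv _) ⟨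
    lam (inv∘ u) (lam u (lam (inv∘ v) z))    ≡⟨ lam-inv∘ˡ u _ ⟩
    lam (inv∘ v) z                           ∎

  lam-inv∘-self : ∀ u → lam (inv∘ u) u ≡ inv∘ u ⁻¹
  lam-inv∘-self u = begin
    inv∘ u ⁻¹ · (inv∘ u ∘ u)  ≡⟨ cong (inv∘ u ⁻¹ ·_) (trans (∘G.inverseˡ u) oneᵒ≡one) ⟩
    inv∘ u ⁻¹ · one           ≡⟨ identityʳ (inv∘ u ⁻¹) ⟩
    inv∘ u ⁻¹                 ∎

  lam-// : ∀ a x y → lam a (x · y ⁻¹) ≡ lam a x · lam a y ⁻¹
  lam-// a x y = trans (lam-· a x (y ⁻¹)) (cong (lam a x ·_) (lam-⁻¹ a y))

  rho-conj : ∀ b a → rho b a ≡ lam (inv∘ (lam a b)) (a ^ lam a b)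
  rho-conj b a = begin
    v ∘ a ∘ b                        ≡⟨ ∘G.assoc v a b ⟩
    v ∘ (a ∘ b)                      ≡⟨ cong (v ∘_) (·-lam a b) ⟨
    v ∘ (a · u)                      ≡⟨ ·-lam v (a · u) ⟨
    v · lam v (a · u)                ≡⟨ cong (_· lam v (a · u)) v≡lam-v-u⁻¹ ⟩
    lam v u ⁻¹ · lam v (a · u)       ≡⟨ cong (lam v u ⁻¹ ·_) (lam-· v a u) ⟩
    lam v u ⁻¹ · (lam v a · lam v u) ≡⟨ assoc (lam v u ⁻¹) (lam v a) (lam v u) ⟨
    lam v a ^ lam v u                ≡⟨ lam-^ v a u ⟨
    lam v (a ^ u)                    ∎
    where
    u = lam a b
    v = inv∘ u
    v≡lam-v-u⁻¹ : v ≡ lam v u ⁻¹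
    v≡lam-v-u⁻¹ = trans (sym (⁻¹-involutive v)) (cong _⁻¹ (sym (lam-inv∘-self u)))

  -- ā ranges over B as a does, and λ_ā maps λ_a(c) to c and a to ā⁻¹.
  lam-commute-self⇒central : ∀ {c} → (∀ a → Commute (lam a c) a) → Central c
  lam-commute-self⇒central {c} commutes t =
    subst (Commute c) inv∘a⁻¹≡t
      (subst₂ Commute (lam-inv∘ˡ a c) (lam-inv∘-self a) (lam-commute (inv∘ a) (commutes a)))
    where
    a = inv∘ (t ⁻¹)
    inv∘a⁻¹≡t : inv∘ a ⁻¹ ≡ t
    inv∘a⁻¹≡t = trans (cong _⁻¹ (∘P.⁻¹-involutive (t ⁻¹))) (⁻¹-involutive t)

  module _ (lam-lam : ∀ x y z → lam (lam x y) z ≡ lam y z)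
           (rho-lam : ∀ x y z → rho (lam x y) z ≡ rho y z) where

    lam-inv∘-lam : ∀ x y z → lam (inv∘ (lam x y)) z ≡ lam (inv∘ y) z
    lam-inv∘-lam x y = lam-inv∘-cong (lam-lam x y)

    ^-lam-lam : ∀ x y a → a ^ lam a (lam x y) ≡ a ^ lam a y
    ^-lam-lam x y a = lam-injective (inv∘ y) (begin
      lam (inv∘ y) (a ^ lam a (lam x y))                  ≡⟨ lam-inv∘-lam x y _ ⟨
      lam (inv∘ (lam x y)) (a ^ lam a (lam x y))          ≡⟨ lam-inv∘-lam a (lam x y) _ ⟨
      lam (inv∘ (lam a (lam x y))) (a ^ lam a (lam x y))  ≡⟨ rho-conj (lam x y) a ⟨
      rho (lam x y) a                                     ≡⟨ rho-lam x y a ⟩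
      rho y a                                             ≡⟨ rho-conj y a ⟩
      lam (inv∘ (lam a y)) (a ^ lam a y)                  ≡⟨ lam-inv∘-lam a y _ ⟩
      lam (inv∘ y) (a ^ lam a y)                          ∎)

    lam-∼ : ∀ x y → lam x y ∼ y
    lam-∼ x y = lam-commute-self⇒central λ a →
      subst (λ d → Commute d a) (sym (lam-// a (lam x y) y)) (^-≈⇒commute (^-lam-lam x y a))

    rho-≡-lam-^ : ∀ b a → rho b a ≡ lam (inv∘ b) (a ^ b)
    rho-≡-lam-^ b a = begin
      rho b a                               ≡⟨ rho-conj b a ⟩
      lam (inv∘ (lam a b)) (a ^ lam a b)    ≡⟨ lam-inv∘-lam a b _ ⟩
      lam (inv∘ b) (a ^ lam a b)            ≡⟨ cong (lam (inv∘ b)) (∼⇒^-≈ (lam-∼ a b)) ⟩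
      lam (inv∘ b) (a ^ b)                  ∎

    rho-∼-^ : ∀ x y → rho x y ∼ y ^ x
    rho-∼-^ x y = subst (_∼ y ^ x) (sym (rho-≡-lam-^ x y)) (lam-∼ (inv∘ x) (y ^ x))

    module _ (rho-rho : ∀ x y z → rho (rho x y) z ≡ rho y z)
             (lam-rho : ∀ x y z → lam (rho x y) z ≡ lam y z) where

      rho-∼ : ∀ x y → rho x y ∼ y
      rho-∼ x y a = ^-≈⇒commute (lam-injective (inv∘ y) (begin
        lam (inv∘ y) (a ^ w)      ≡⟨ lam-inv∘-cong (lam-rho x y) _ ⟨
        lam (inv∘ w) (a ^ w)      ≡⟨ rho-≡-lam-^ w a ⟨
        rho w a                   ≡⟨ rho-rho x y a ⟩
        rho y a                   ≡⟨ rho-≡-lam-^ y a ⟩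
        lam (inv∘ y) (a ^ y)      ∎))
        where
        w = rho x y

      conjugate-∼ : ∀ x y → y ^ x ∼ y
      conjugate-∼ x y = ∼-trans (∼-sym (rho-∼-^ x y)) (rho-∼ x y)

corollary6p5 : ∀ {ℓ : Level} (S : SkewBrace ℓ) → SkewBrace.Is2Reductive S → SkewBrace.NilpotentClass≤2 S
corollary6p5 S (lam-lam , rho-rho , lam-rho , rho-lam) =
  Centre.conjugates-∼⇒commutators-central ·-group
    (conjugate-∼ lam-lam rho-lam rho-rho lam-rho)
  where
  open SkewBraceProperties S
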